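{- Let $\lambda,\mu$ be strict partitions with $\mu\subseteq\lambda$, and let $\mathcal{C},\mathcal{C}'$ be configurations for $\lambda/\mu$ such that $\mathcal{C}'$ is obtained from $\mathcal{C}$ by exchanging the $0$'s of two rows $a$ and $b$, where in $\mathcal{C}$ row $a$ has type $(e,e)$ and row $b$ has type $(o,e)$, and in $\mathcal{C}'$ row $a$ has type $(o,o)$ and row $b$ has type $(e,o)$. Then $\kappa(\mathcal{C}')<\kappa(\mathcal{C})$.
   Context: Let $S(\lambda)$ be the shifted diagram of $\lambda$ (row $i$ of the Young diagram shifted $i-1$ squares right). A configuration $\mathcal{C}$ of $0$'s for $\lambda/\mu$ assigns to each row $i$ an integer $z_i$ with $0\le z_i\le\lambda_i$ (the leftmost $z_i$ squares of row $i$ are filled with $0$, the other $\lambda_i-z_i$ squares are blank), such that the nonzero $z_i$'s, arranged in decreasing order, are exactly the parts of $\mu$. Exchanging the $0$'s of rows $a\ne b$ means replacing $(z_a,z_b)$ by $(z_b,z_a)$ (when this is again a configuration). Row types: $(e,e)$: $z_i>0$ even and $\lambda_i-z_i>0$ even; $(e,o)$: $z_i>0$ even, $\lambda_i-z_i$ odd; $(o,e)$: $z_i$ odd, $\lambda_i-z_i>0$ even; $(o,o)$: $z_i$ odd, $\lambda_i-z_i$ odd; $(\emptyset,e)$: $z_i=0$, $\lambda_i$ even; $(\emptyset,o)$: $z_i=0$, $\lambda_i$ odd; $(e,\emptyset)$: $z_i=\lambda_i$ even; $(o,\emptyset)$: $z_i=\lambda_i$ odd. Let $o_r$ (resp. $e_r$)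 be the number of rows with $z_i=0$ and $\lambda_i$ odd (resp. even), and $o_s$ (resp. $e_s$) the number of rows with $z_i>0$ and $\lambda_i-z_i$ odd (resp. even and nonzero). Define $\kappa(\mathcal{C})=o_s+2e_s+\max\big(o_r,\ e_r+((e_r+o_r)\bmod 2)\big)$. -}

module Defs where

open import Data.Nat using (ℕ; zero; suc; _+_; _*_; _∸_; _≤_; _<_; _⊔_; _%_)
open import Data.Nat.Properties using (_≟_)
open import Data.Fin using (Fin; toℕ)
open import Data.List using (List; length; filter; tabulate; allFin)
open import Data.List.Relation.Binary.Permutation.Propositional using (_↭_)
open import Data.Product using (_×_)
open import Relation.Binary.PropositionalEquality using (_≡_; _≢_)
open import Relation.Nullary using (¬_; Dec)
open import Relation.Nullary.Decidable using (_×-dec_; ¬?)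

Even : ℕ → Set
Even n = n % 2 ≡ 0

Odd : ℕ → Set
Odd n = n % 2 ≡ 1

even? : (n : ℕ) → Dec (Even n)
even? n = (n % 2) ≟ 0

odd? : (n : ℕ) → Dec (Odd n)
odd? n = (n % 2) ≟ 1

StrictPartition : (n : ℕ) → (Fin n → ℕ) → Set
StrictPartition n la =
  ((i : Fin n) → 0 < la i) × ((i j : Fin n) → toℕ i < toℕ j → la j < la i)

Contained : (m n : ℕ) → (Fin m → ℕ) → (Fin n → ℕ) → Set
Contained m n mu la =
  (m ≤ n) × ((i : Fin m) (j : Fin n) → toℕ i ≡ toℕ j → mu i ≤ la j)

nonzeros : (n : ℕ) → (Fin n → ℕ) → List ℕ
nonzeros n z = filter (λ x → ¬? (x ≟ 0)) (tabulate z)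

-- A configuration of 0's for λ/μ: z i ≤ λ i for all rows, and the nonzero
-- z i's, arranged in decreasing order, are exactly the parts of μ
-- (equivalently, as multisets: the list of nonzero z i's is a permutation
-- of the list of parts of μ, which is already in decreasing order).
Configuration : (m n : ℕ) → (Fin m → ℕ) → (Fin n → ℕ) → (Fin n → ℕ) → Set
Configuration m n mu la z =
  ((i : Fin n) → z i ≤ la i) × (nonzeros n z ↭ tabulate mu)

Exchanged : (n : ℕ) → (z z' : Fin n → ℕ) → Fin n → Fin n → Set
Exchanged n z z' a b =
  (a ≢ b) × (z' a ≡ z b) × (z' b ≡ z a) ×
  ((i : Fin n) → i ≢ a → i ≢ b → z' i ≡ z i)

-- Row types (z = number of 0's in the row, l = row length λ_i).
TypeEE : ℕ → ℕ → Set
TypeEE l z = (0 < z × Even z) × (0 < l ∸ z × Even (l ∸ z))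

TypeOE : ℕ → ℕ → Set
TypeOE l z = Odd z × (0 < l ∸ z × Even (l ∸ z))

TypeOO : ℕ → ℕ → Set
TypeOO l z = Odd z × Odd (l ∸ z)

TypeEO : ℕ → ℕ → Set
TypeEO l z = (0 < z × Even z) × Odd (l ∸ z)

count : (n : ℕ) → {P : Fin n → Set} → ((i : Fin n) → Dec (P i)) → ℕ
count n P? = length (filter P? (allFin n))

oR eR oS eS : (n : ℕ) → (Fin n → ℕ) → (Fin n → ℕ) → ℕ
oR n la z = count n (λ i → (z i ≟ 0) ×-dec odd? (la i))
eR n la z = count n (λ i → (z i ≟ 0) ×-dec even? (la i))
oS n la z = count n (λ i → ¬? (z i ≟ 0) ×-dec odd? (la i ∸ z i))
eS n la z = count n (λ i → ¬? (z i ≟ 0) ×-dec (even? (la i ∸ z i) ×-dec ¬? ((la i ∸ z i) ≟ 0)))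

kappa : (n : ℕ) → (Fin n → ℕ) → (Fin n → ℕ) → ℕ
kappa n la z =
  oS n la z + 2 * eS n la z
    + (oR n la z ⊔ (eR n la z + ((eR n la z + oR n la z) % 2)))

-- Only rows a and b change, and both contain 0's before and after the exchange, so o_r and
-- e_r are unchanged.  The blank parts of both rows pass from even and nonempty to odd, so
-- each of them moves from e_s to o_s: o_s grows by 2 and e_s drops by 2, hence κ drops by 2.
module Submission where

open import Defs
open import Data.Nat using (ℕ; suc; _+_; _*_; _∸_; _⊔_; _%_; _<_; z<s)
open import Data.Nat.Properties
  using (+-0-commutativeMonoid; +-commutativeSemigroup; +-assoc; _≟_; 0≢1+n; n>0⇒n≢0; m<n+m)
open import Algebra.Properties.CommutativeMonoid.Sum +-0-commutativeMonoid
  using (sum; sum-remove; sum-cong-≗)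
open import Algebra.Properties.CommutativeSemigroup +-commutativeSemigroup
  using (x∙yz≈y∙xz; xy∙z≈y∙xz)
open import Data.Fin using (Fin; zero; suc; punchIn)
import Data.Fin.Properties as Fin
open import Data.List using (filter; length; tabulate)
open import Data.Nat.Tactic.RingSolver using (solve-∀)
open import Data.Product using (_×_; _,_; proj₁)
open import Data.Vec.Functional using (Vector; updateAt)
open import Data.Vec.Functional.Properties using (updateAt-updates; updateAt-minimal)
open import Function using (_∘_; const)
open import Relation.Binary.PropositionalEquality
open import Relation.Nullary using (¬_; Dec; yes; no; contradiction)
open import Relation.Nullary.Decidable using (_×-dec_; ¬?)
open ≡-Reasoning

indicator : {P : Set} → Dec P → ℕ
indicator (yes _) = 1
indicator (no _)  = 0

indicator-yes : {P : Set} → P → (P? : Dec P) → indicator P? ≡ 1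
indicator-yes p (yes _) = refl
indicator-yes p (no ¬p) = contradiction p ¬p

indicator-no : {P : Set} → ¬ P → (P? : Dec P) → indicator P? ≡ 0
indicator-no ¬p (yes p) = contradiction p ¬p
indicator-no ¬p (no _)  = refl

sum-exchange : ∀ {n} (f g : Vector ℕ n) (a : Fin n) → (∀ i → i ≢ a → f i ≡ g i)
  → f a + sum g ≡ g a + sum f
sum-exchange {suc n} f g a f≡g = begin
  f a + sum g                          ≡⟨ cong (f a +_) (sum-remove {i = a} g) ⟩
  f a + (g a + sum (g ∘ punchIn a))    ≡⟨ x∙yz≈y∙xz (f a) (g a) _ ⟩
  g a + (f a + sum (g ∘ punchIn a))    ≡⟨ cong (λ s → g a + (f a + s)) (sum-cong-≗ g≡f) ⟩
  g a + (f a + sum (f ∘ punchIn a))    ≡⟨ cong (g a +_) (sum-remove {i = a} f) ⟨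
  g a + sum f                          ∎
  where
  g≡f : ∀ j → g (punchIn a j) ≡ f (punchIn a j)
  g≡f j = sym (f≡g (punchIn a j) (Fin.punchInᵢ≢i a j))

sum-exchange₂ : ∀ {n} (f g : Vector ℕ n) {a b : Fin n} → a ≢ b
  → (∀ i → i ≢ a → i ≢ b → f i ≡ g i)
  → f a + f b + sum g ≡ g a + g b + sum f
sum-exchange₂ f g {a} {b} a≢b f≡g = begin
  f a + f b + sum g      ≡⟨ xy∙z≈y∙xz (f a) (f b) (sum g) ⟩
  f b + (f a + sum g)    ≡⟨ cong (f b +_) (trans (cong (_+ sum g) (sym ha)) (sum-exchange h g a h≡g)) ⟩
  f b + (g a + sum h)    ≡⟨ x∙yz≈y∙xz (f b) (g a) (sum h) ⟩
  g a + (f b + sum h)    ≡⟨ cong (g a +_) (trans (sum-exchange f h b f≡h) (cong (_+ sum f) hb)) ⟩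
  g a + (g b + sum f)    ≡⟨ +-assoc (g a) (g b) (sum f) ⟨
  g a + g b + sum f      ∎
  where
  h : Vector ℕ _
  h = updateAt g a (const (f a))
  ha : h a ≡ f a
  ha = updateAt-updates a g
  hb : h b ≡ g b
  hb = updateAt-minimal b a g (a≢b ∘ sym)
  h≡g : ∀ i → i ≢ a → h i ≡ g i
  h≡g i i≢a = updateAt-minimal i a g i≢a
  f≡h : ∀ i → i ≢ b → f i ≡ h i
  f≡h i i≢b with i Fin.≟ a
  ... | yes refl = sym ha
  ... | no i≢a   = trans (f≡g i i≢a i≢b) (sym (h≡g i i≢a))

length-filter-tabulate : ∀ {n} {A : Set} {P : A → Set} (P? : ∀ x → Dec (P x)) (f : Fin n → A)
  → length (filter P? (tabulate f)) ≡ sum (λ i → indicator (P? (f i)))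
length-filter-tabulate {ℕ.zero} P? f = refl
length-filter-tabulate {suc n}  P? f with P? (f zero)
... | yes _ = cong suc (length-filter-tabulate P? (f ∘ suc))
... | no _  = length-filter-tabulate P? (f ∘ suc)

count≡sum : ∀ n {P : Fin n → Set} (P? : ∀ i → Dec (P i)) → count n P? ≡ sum (indicator ∘ P?)
count≡sum n P? = length-filter-tabulate P? (λ i → i)

module _ {n} {A : Set} {R : Fin n → A → Set} (R? : ∀ i x → Dec (R i x))
         {z z' : Vector A n} {a b : Fin n} (a≢b : a ≢ b) (z'≡z : ∀ i → i ≢ a → i ≢ b → z' i ≡ z i)
         where

  private
    countAt : Vector A n → ℕ
    countAt w = count n (λ i → R? i (w i))

    χ : Vector A n → Fin n → ℕ
    χ w i = indicator (R? i (w i))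

    χ-yes : ∀ w i → R i (w i) → χ w i ≡ 1
    χ-yes w i r = indicator-yes r (R? i (w i))

    χ-no : ∀ w i → ¬ R i (w i) → χ w i ≡ 0
    χ-no w i ¬r = indicator-no ¬r (R? i (w i))

  count-exchange : χ z a + χ z b + countAt z' ≡ χ z' a + χ z' b + countAt z
  count-exchange = begin
    χ z a + χ z b + countAt z'     ≡⟨ cong (χ z a + χ z b +_) (count≡sum n _) ⟩
    χ z a + χ z b + sum (χ z')     ≡⟨ sum-exchange₂ (χ z) (χ z') a≢b agree ⟩
    χ z' a + χ z' b + sum (χ z)    ≡⟨ cong (χ z' a + χ z' b +_) (count≡sum n _) ⟨
    χ z' a + χ z' b + countAt z    ∎
    where
    agree : ∀ i → i ≢ a → i ≢ b → χ z i ≡ χ z' i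
    agree i i≢a i≢b = cong (indicator ∘ R? i) (sym (z'≡z i i≢a i≢b))

  count-exchange-stable : ¬ R a (z a) → ¬ R b (z b) → ¬ R a (z' a) → ¬ R b (z' b)
    → countAt z' ≡ countAt z
  count-exchange-stable ¬za ¬zb ¬z'a ¬z'b = begin
    countAt z'                    ≡⟨ cong₂ (λ p q → p + q + countAt z') (χ-no z a ¬za) (χ-no z b ¬zb) ⟨
    χ z a + χ z b + countAt z'    ≡⟨ count-exchange ⟩
    χ z' a + χ z' b + countAt z   ≡⟨ cong₂ (λ p q → p + q + countAt z) (χ-no z' a ¬z'a) (χ-no z' b ¬z'b) ⟩
    countAt z                     ∎

  count-exchange-gain : ¬ R a (z a) → ¬ R b (z b) → R a (z' a) → R b (z' b)
    → countAt z' ≡ 2 + countAt z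
  count-exchange-gain ¬za ¬zb z'a z'b = begin
    countAt z'                    ≡⟨ cong₂ (λ p q → p + q + countAt z') (χ-no z a ¬za) (χ-no z b ¬zb) ⟨
    χ z a + χ z b + countAt z'    ≡⟨ count-exchange ⟩
    χ z' a + χ z' b + countAt z   ≡⟨ cong₂ (λ p q → p + q + countAt z) (χ-yes z' a z'a) (χ-yes z' b z'b) ⟩
    2 + countAt z                 ∎

EvenSplit OddSplit : ℕ → ℕ → Set
EvenSplit l x = x ≢ 0 × (Even (l ∸ x) × l ∸ x ≢ 0)
OddSplit  l x = x ≢ 0 × Odd (l ∸ x)

evenSplit? : ∀ l x → Dec (EvenSplit l x)
evenSplit? l x = ¬? (x ≟ 0) ×-dec (even? (l ∸ x) ×-dec ¬? ((l ∸ x) ≟ 0))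

oddSplit? : ∀ l x → Dec (OddSplit l x)
oddSplit? l x = ¬? (x ≟ 0) ×-dec odd? (l ∸ x)

odd⇒≢0 : ∀ {x} → Odd x → x ≢ 0
odd⇒≢0 {ℕ.zero} ()
odd⇒≢0 {suc x}  _ ()

even⇒¬odd : ∀ {x} → Even x → ¬ Odd x
even⇒¬odd even odd = 0≢1+n (trans (sym even) odd)

evenSplit⇒¬oddSplit : ∀ {l x} → EvenSplit l x → ¬ OddSplit l x
evenSplit⇒¬oddSplit {l} {x} (_ , even , _) (_ , odd) = even⇒¬odd {l ∸ x} even odd

oddSplit⇒¬evenSplit : ∀ {l x} → OddSplit l x → ¬ EvenSplit l x
oddSplit⇒¬evenSplit odd even = evenSplit⇒¬oddSplit even odd

typeEE⇒evenSplit : ∀ {l x} → TypeEE l x → EvenSplit l x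
typeEE⇒evenSplit ((x>0 , _) , (r>0 , r-even)) = n>0⇒n≢0 x>0 , r-even , n>0⇒n≢0 r>0

typeOE⇒evenSplit : ∀ {l x} → TypeOE l x → EvenSplit l x
typeOE⇒evenSplit (x-odd , (r>0 , r-even)) = odd⇒≢0 x-odd , r-even , n>0⇒n≢0 r>0

typeOO⇒oddSplit : ∀ {l x} → TypeOO l x → OddSplit l x
typeOO⇒oddSplit (x-odd , r-odd) = odd⇒≢0 x-odd , r-odd

typeEO⇒oddSplit : ∀ {l x} → TypeEO l x → OddSplit l x
typeEO⇒oddSplit ((x>0 , _) , r-odd) = n>0⇒n≢0 x>0 , r-odd

kappa-arith : ∀ s e m → 2 + (2 + s + 2 * e + m) ≡ s + 2 * (2 + e) + m
kappa-arith = solve-∀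

kappa-exchange : ∀ {n} (la z z' : Vector ℕ n) {a b : Fin n} → a ≢ b
  → (∀ i → i ≢ a → i ≢ b → z' i ≡ z i)
  → EvenSplit (la a) (z a) → EvenSplit (la b) (z b)
  → OddSplit (la a) (z' a) → OddSplit (la b) (z' b)
  → 2 + kappa n la z' ≡ kappa n la z
kappa-exchange {n} la z z' {a} {b} a≢b z'≡z za zb z'a z'b = begin
  2 + kappa n la z'
    ≡⟨ cong₂ (λ s r → 2 + (s + 2 * eS n la z' + r)) oS-gain emptyRows-stable ⟩
  2 + (2 + oS n la z + 2 * eS n la z' + emptyRows z)
    ≡⟨ kappa-arith (oS n la z) (eS n la z') (emptyRows z) ⟩
  oS n la z + 2 * (2 + eS n la z') + emptyRows z
    ≡⟨ cong (λ e → oS n la z + 2 * e + emptyRows z) eS-loss ⟩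
  kappa n la z
    ∎
  where
  emptyRows : Vector ℕ n → ℕ
  emptyRows w = oR n la w ⊔ (eR n la w + ((eR n la w + oR n la w) % 2))

  nonempty : ∀ {P : Set} {x} → x ≢ 0 → ¬ (x ≡ 0 × P)
  nonempty x≢0 (x≡0 , _) = x≢0 x≡0

  oR-stable : oR n la z' ≡ oR n la z
  oR-stable = count-exchange-stable (λ i x → (x ≟ 0) ×-dec odd? (la i)) a≢b z'≡z
    (nonempty (proj₁ za)) (nonempty (proj₁ zb)) (nonempty (proj₁ z'a)) (nonempty (proj₁ z'b))

  eR-stable : eR n la z' ≡ eR n la z
  eR-stable = count-exchange-stable (λ i x → (x ≟ 0) ×-dec even? (la i)) a≢b z'≡z
    (nonempty (proj₁ za)) (nonempty (proj₁ zb)) (nonempty (proj₁ z'a)) (nonempty (proj₁ z'b))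

  emptyRows-stable : emptyRows z' ≡ emptyRows z
  emptyRows-stable = cong₂ (λ r e → r ⊔ (e + ((e + r) % 2))) oR-stable eR-stable

  oS-gain : oS n la z' ≡ 2 + oS n la z
  oS-gain = count-exchange-gain (oddSplit? ∘ la) a≢b z'≡z
    (evenSplit⇒¬oddSplit za) (evenSplit⇒¬oddSplit zb) z'a z'b

  eS-loss : 2 + eS n la z' ≡ eS n la z
  eS-loss = sym (count-exchange-gain (evenSplit? ∘ la) a≢b (λ i i≢a i≢b → sym (z'≡z i i≢a i≢b))
    (oddSplit⇒¬evenSplit z'a) (oddSplit⇒¬evenSplit z'b) za zb)

mainTheorem8 : (m n : ℕ) (mu : Fin m → ℕ) (la : Fin n → ℕ)
    → StrictPartition n la → StrictPartition m mu → Contained m n mu la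
    → (z z' : Fin n → ℕ) → Configuration m n mu la z → Configuration m n mu la z'
    → (a b : Fin n) → Exchanged n z z' a b
    → TypeEE (la a) (z a) → TypeOE (la b) (z b)
    → TypeOO (la a) (z' a) → TypeEO (la b) (z' b)
    → kappa n la z' < kappa n la z
mainTheorem8 _ n _ la _ _ _ z z' _ _ a b (a≢b , _ , _ , z'≡z) za zb z'a z'b =
  subst (kappa n la z' <_) κ-drops-by-2 (m<n+m (kappa n la z') {2} z<s)
  where
  κ-drops-by-2 : 2 + kappa n la z' ≡ kappa n la z
  κ-drops-by-2 = kappa-exchange la z z' a≢b z'≡z
    (typeEE⇒evenSplit za) (typeOE⇒evenSplit zb) (typeOO⇒oddSplit z'a) (typeEO⇒oddSplit z'b)
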